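{- A map $\varepsilon\colon X^{\times}_{\mathrm{irr}}\to\mathcal{P}(M)$ is not a Fitch map if and only if there are (not necessarily distinct) colors $m,m'\in M$ such that either (I) there is a 3-element subset $\{a,b,c\}\subseteq X$ with $m\in\varepsilon(c,b)$ and $m\notin\varepsilon(a,b)$ that satisfies one of: (1) $m\notin\varepsilon(c,a)$; (2a) $m'\notin\varepsilon(a,c)$ and $m'\in\varepsilon(b,c)$; (2b) $m'\in\varepsilon(a,c)$ and $m'\notin\varepsilon(b,c)$; (3) $m\neq m'$, $m'\notin\varepsilon(c,b)$ and $m'\in\varepsilon(a,b)$; or (II) there is a 4-element subset $\{a,b,c,d\}\subseteq X$ with $m\in\varepsilon(c,b)$ and $m\notin\varepsilon(a,b)$ that satisfies (4) $m\neq m'$, $m'\notin\varepsilon(b,d)\cup\varepsilon(c,d)$ and $m'\in\varepsilon(a,d)$.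
   Context: $X$ is a finite nonempty set, $M$ a finite nonempty set of colors, $X^{\times}_{\mathrm{irr}}=\{(x,y)\in X\times X: x\neq y\}$. A phylogenetic tree on $X$ is a rooted tree whose leaves (non-root vertices of degree $1$) form $X$, whose root has degree $\ge2$ and whose non-root inner vertices have degree $\ge3$; $\mathrm{lca}(x,y)$ is the last common ancestor. An edge-labeled tree $(T,\lambda)$ on $X$ with $M$ is a phylogenetic tree $T$ on $X$ with $\lambda\colon E(T)\to\mathcal{P}(M)$; $e$ is an $m$-edge if $m\in\lambda(e)$. $(T,\lambda)$ explains $\varepsilon$ if for all $(x,y)\in X^{\times}_{\mathrm{irr}}$, $m\in M$: $m\in\varepsilon(x,y)$ iff the path from $\mathrm{lca}(x,y)$ to $y$ contains an $m$-edge; $\varepsilon$ is a Fitch map if some edge-labeled tree explains it. -}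

module Defs where

open import Data.Nat using (ℕ; _≤_)
open import Data.Fin using (Fin)
open import Data.Fin.Subset using (Subset; _∈_; _∉_)
open import Data.List using (List; []; _∷_; _++_; length; lookup)
open import Data.List.Relation.Unary.All using (All)
open import Data.List.Relation.Unary.Unique.Propositional using (Unique)
open import Data.List.Membership.Propositional using () renaming (_∈_ to _∈ₗ_)
open import Data.Product using (Σ; _×_; _,_; proj₁; proj₂; ∃-syntax)
open import Data.Sum using (_⊎_)
open import Relation.Binary.PropositionalEquality using (_≢_)
open import Function.Bundles using (_⇔_)
open import Relation.Nullary using (¬_)

-- Leaf set X = Fin n, color set M = Fin k.  P(M) = Subset k.
-- A rooted tree: either a single vertex (a leaf, used only for |X| = 1),
-- or a vertex with a list of children, each child reached by an edge
-- carrying a label λ(e) ∈ P(M).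
data Tree (n k : ℕ) : Set where
  leaf : Fin n → Tree n k
  node : List (Subset k × Tree n k) → Tree n k

module _ {n k : ℕ} where

  mutual
    leaves : Tree n k → List (Fin n)
    leaves (leaf x) = x ∷ []
    leaves (node cs) = leavesL cs

    leavesL : List (Subset k × Tree n k) → List (Fin n)
    leavesL [] = []
    leavesL ((_ , t) ∷ cs) = leaves t ++ leavesL cs

  -- every inner vertex has at least two children
  -- (root degree ≥ 2, non-root inner vertex degree ≥ 3)
  data Branching : Tree n k → Set where
    leaf : ∀ {x} → Branching (leaf x)
    node : ∀ {cs} → 2 ≤ length cs → All (λ c → Branching (proj₂ c)) cs →
           Branching (node cs)

  IsPhylogenetic : Tree n k → Set
  IsPhylogenetic t = Branching t × Unique (leaves t) × (∀ x → x ∈ₗ leaves t)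

  data RootPathHas (m : Fin k) (y : Fin n) : Tree n k → Set where
    step : ∀ {cs} (i : Fin (length cs)) →
           y ∈ₗ leaves (proj₂ (lookup cs i)) →
           (m ∈ proj₁ (lookup cs i) ⊎ RootPathHas m y (proj₂ (lookup cs i))) →
           RootPathHas m y (node cs)

  data LcaPathHas (m : Fin k) (x y : Fin n) : Tree n k → Set where
    split : ∀ {cs} (i j : Fin (length cs)) → i ≢ j →
            x ∈ₗ leaves (proj₂ (lookup cs i)) →
            y ∈ₗ leaves (proj₂ (lookup cs j)) →
            (m ∈ proj₁ (lookup cs j) ⊎ RootPathHas m y (proj₂ (lookup cs j))) →
            LcaPathHas m x y (node cs)
    below : ∀ {cs} (i : Fin (length cs)) →
            x ∈ₗ leaves (proj₂ (lookup cs i)) →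
            y ∈ₗ leaves (proj₂ (lookup cs i)) →
            LcaPathHas m x y (proj₂ (lookup cs i)) →
            LcaPathHas m x y (node cs)

  -- ε : X^×_irr → P(M), represented as a map on X × X whose diagonal is ignored
  ColorMap : Set
  ColorMap = Fin n → Fin n → Subset k

  Explains : Tree n k → ColorMap → Set
  Explains t ε = ∀ (x y : Fin n) → x ≢ y → ∀ (m : Fin k) →
                 (m ∈ ε x y) ⇔ LcaPathHas m x y t

  IsFitch : ColorMap → Set
  IsFitch ε = Σ (Tree n k) λ t → IsPhylogenetic t × Explains t ε

  CondI : ColorMap → Fin k → Fin k → Set
  CondI ε m m' = ∃[ a ] ∃[ b ] ∃[ c ] (a ≢ b × a ≢ c × b ≢ c ×
    m ∈ ε c b × m ∉ ε a b ×
    ( m ∉ ε c a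
    ⊎ (m' ∉ ε a c × m' ∈ ε b c)
    ⊎ (m' ∈ ε a c × m' ∉ ε b c)
    ⊎ (m ≢ m' × m' ∉ ε c b × m' ∈ ε a b)))

  CondII : ColorMap → Fin k → Fin k → Set
  CondII ε m m' = ∃[ a ] ∃[ b ] ∃[ c ] ∃[ d ]
    (a ≢ b × a ≢ c × a ≢ d × b ≢ c × b ≢ d × c ≢ d ×
     m ∈ ε c b × m ∉ ε a b ×
     m ≢ m' × m' ∉ ε b d × m' ∉ ε c d × m' ∈ ε a d)

-- If ε is explained by a tree, m ∈ ε(c,b) together with m ∉ ε(a,b) forces lca(a,b) strictly below
-- lca(b,c), and each of (1)–(4) contradicts the edge pattern of such a resolved triple (or quartet).
-- Conversely, if no condition holds, the sets {x : x = y or m ∉ ε(x,y)} behave like the leaf sets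
-- below the lowest m-edge above y: any two of them are nested or disjoint. A tree is then built top
-- down: a leaf set S is cut along a largest such set belonging to a colour that occurs on a root path
-- within S, the colours any z ∈ S sends to y are placed on the root path of y, and the failure of
-- condition (1) shows that they can be placed on the edge of the split.
module Submission where

open import Defs
open import Data.Nat using (ℕ; zero; suc; _≤_; _<_; s≤s; z≤n)
open import Data.Nat.Induction using (<-wellFounded)
open import Data.Nat.Properties using (≤-totalOrder; <⇒≱)
open import Data.Fin using (Fin; zero; suc)
open import Data.Fin.Properties using (any?; all?) renaming (_≟_ to _≟ᶠ_)
open import Data.Fin.Subset using (Subset; _∈_; _∉_; _⊆_; _⊂_; Nonempty; ∣_∣; ⊤)
open import Data.Fin.Subset.Properties using (_∈?_; ∈⊤; x∈⁅x⁆; x∈⁅y⁆⇒x≡y; p⊂q⇒∣p∣<∣q∣)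
open import Data.Vec using (tabulate)
open import Data.Vec.Properties using (lookup∘tabulate; lookup⇒[]=; []=⇒lookup)
open import Data.List using (List; []; _∷_; _++_; length; lookup; filter; cartesianProduct; allFin)
open import Data.List.Extrema ≤-totalOrder using (argmax; argmax-all; f[⊥]≤f[argmax]; f[xs]≤f[argmax])
open import Data.List.Membership.Propositional using () renaming (_∈_ to _∈ₗ_)
open import Data.List.Membership.Propositional.Properties
  using (∈-++⁺ˡ; ∈-++⁺ʳ; ∈-++⁻; ∈-filter⁺; ∈-cartesianProduct⁺; ∈-allFin)
open import Data.List.Relation.Binary.Disjoint.Propositional using (Disjoint)
open import Data.List.Relation.Unary.All as All using (All; []; _∷_)
open import Data.List.Relation.Unary.All.Properties using (++⁻ˡ; ++⁻ʳ; all-filter)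
open import Data.List.Relation.Unary.AllPairs using ([]; _∷_)
open import Data.List.Relation.Unary.Any using (here; there)
open import Data.List.Relation.Unary.Unique.Propositional using (Unique)
open import Data.List.Relation.Unary.Unique.Propositional.Properties using (++⁺)
open import Data.Product using (_×_; _,_; proj₁; proj₂; ∃-syntax)
open import Data.Sum as Sum using (_⊎_; inj₁; inj₂; [_,_]; [_,_]′)
open import Data.Empty using (⊥; ⊥-elim)
open import Function.Base using (_∘_; case_of_)
open import Function.Bundles using (_⇔_; Equivalence; mk⇔)
open import Induction.WellFounded using (Acc; acc)
open import Relation.Binary.PropositionalEquality using (_≡_; _≢_; refl; sym; trans; cong; subst)
open import Relation.Nullary using (¬_; Dec; yes; no; ¬?)
open import Relation.Nullary.Decidable using (does; dec-true; decidable-stable; _×-dec_; _⊎-dec_; _→-dec_)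
import Relation.Unary as U

open Equivalence

module _ {A : Set} where

  unique-++⁻ˡ : ∀ xs {ys : List A} → Unique (xs ++ ys) → Unique xs
  unique-++⁻ˡ []       _         = []
  unique-++⁻ˡ (x ∷ xs) (x∉ ∷ u) = ++⁻ˡ xs x∉ ∷ unique-++⁻ˡ xs u

  unique-++⁻ʳ : ∀ xs {ys : List A} → Unique (xs ++ ys) → Unique ys
  unique-++⁻ʳ []       u       = u
  unique-++⁻ʳ (x ∷ xs) (_ ∷ u) = unique-++⁻ʳ xs u

  unique-++⇒disjoint : ∀ xs {ys : List A} → Unique (xs ++ ys) → Disjoint xs ys
  unique-++⇒disjoint (x ∷ xs) (x∉ ∷ u) (here refl , v∈ys) = All.lookup (++⁻ʳ xs x∉) v∈ys refl
  unique-++⇒disjoint (x ∷ xs) (_ ∷ u)  (there v∈xs , v∈ys) = unique-++⇒disjoint xs u (v∈xs , v∈ys)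

module _ {n k : ℕ} where

  Children : Set
  Children = List (Subset k × Tree n k)

  child : (cs : Children) → Fin (length cs) → Tree n k
  child cs i = proj₂ (lookup cs i)

  label : (cs : Children) → Fin (length cs) → Subset k
  label cs i = proj₁ (lookup cs i)

  ∈-leavesL⁻ : ∀ {x} cs → x ∈ₗ leavesL cs → ∃[ i ] x ∈ₗ leaves (child cs i)
  ∈-leavesL⁻ ((_ , t) ∷ cs) x∈ with ∈-++⁻ (leaves t) x∈
  ... | inj₁ x∈t  = zero , x∈t
  ... | inj₂ x∈cs with ∈-leavesL⁻ cs x∈cs
  ...   | i , x∈i = suc i , x∈i

  ∈-leavesL⁺ : ∀ {x} cs i → x ∈ₗ leaves (child cs i) → x ∈ₗ leavesL cs
  ∈-leavesL⁺ (_ ∷ cs)       zero    x∈ = ∈-++⁺ˡ x∈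
  ∈-leavesL⁺ ((_ , t) ∷ cs) (suc i) x∈ = ∈-++⁺ʳ (leaves t) (∈-leavesL⁺ cs i x∈)

  unique⇒unique-child : ∀ cs → Unique (leavesL cs) → ∀ i → Unique (leaves (child cs i))
  unique⇒unique-child ((_ , t) ∷ cs) u zero    = unique-++⁻ˡ (leaves t) u
  unique⇒unique-child ((_ , t) ∷ cs) u (suc i) = unique⇒unique-child cs (unique-++⁻ʳ (leaves t) u) i

  child-index-unique : ∀ {x} cs → Unique (leavesL cs) → ∀ i j →
                 x ∈ₗ leaves (child cs i) → x ∈ₗ leaves (child cs j) → i ≡ j
  child-index-unique (_ ∷ cs)       u zero    zero    _   _   = refl
  child-index-unique ((_ , t) ∷ cs) u zero    (suc j) x∈i x∈j =
    ⊥-elim (unique-++⇒disjoint (leaves t) u (x∈i , ∈-leavesL⁺ cs j x∈j))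
  child-index-unique ((_ , t) ∷ cs) u (suc i) zero    x∈i x∈j =
    ⊥-elim (unique-++⇒disjoint (leaves t) u (x∈j , ∈-leavesL⁺ cs i x∈i))
  child-index-unique ((_ , t) ∷ cs) u (suc i) (suc j) x∈i x∈j =
    cong suc (child-index-unique cs (unique-++⁻ʳ (leaves t) u) i j x∈i x∈j)

  LcaPathHas⇒RootPathHas : ∀ {m x y} {t : Tree n k} → LcaPathHas m x y t → RootPathHas m y t
  LcaPathHas⇒RootPathHas (split _ j _ _ y∈ p) = step j y∈ p
  LcaPathHas⇒RootPathHas (below i _ y∈ d)     = step i y∈ (inj₂ (LcaPathHas⇒RootPathHas d))

  module _ {m : Fin k} {x y : Fin n} (cs : Children) (u : Unique (leavesL cs)) where

    lcaPathHas-split⁻ : ∀ {i j} → i ≢ j → x ∈ₗ leaves (child cs i) → y ∈ₗ leaves (child cs j) →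
                        LcaPathHas m x y (node cs) → m ∈ label cs j ⊎ RootPathHas m y (child cs j)
    lcaPathHas-split⁻ {j = j} _ _ y∈ (split _ j' _ _ y∈' p) with child-index-unique cs u j' j y∈' y∈
    ... | refl = p
    lcaPathHas-split⁻ {i} {j} i≢j x∈ y∈ (below l x∈' y∈' _)
      with child-index-unique cs u l i x∈' x∈ | child-index-unique cs u l j y∈' y∈
    ... | refl | refl = ⊥-elim (i≢j refl)

    lcaPathHas-below⁻ : ∀ {i} → x ∈ₗ leaves (child cs i) → y ∈ₗ leaves (child cs i) →
                        LcaPathHas m x y (node cs) → LcaPathHas m x y (child cs i)
    lcaPathHas-below⁻ {i} x∈ y∈ (split i' j' i'≢j' x∈' y∈' _)
      with child-index-unique cs u i' i x∈' x∈ | child-index-unique cs u j' i y∈' y∈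
    ... | refl | refl = ⊥-elim (i'≢j' refl)
    lcaPathHas-below⁻ {i} x∈ _ (below l x∈' _ d) with child-index-unique cs u l i x∈' x∈
    ... | refl = d

  module _ {m : Fin k} {a b : Fin n} where

    sameChild : ∀ {cs} j → b ∈ₗ leaves (child cs j) → m ∈ label cs j ⊎ RootPathHas m b (child cs j) →
                ¬ LcaPathHas m a b (node cs) → a ∈ₗ leavesL cs → a ∈ₗ leaves (child cs j)
    sameChild {cs} j b∈ p ¬ab a∈ with ∈-leavesL⁻ cs a∈
    ... | i , a∈i with i ≟ᶠ j
    ...   | yes refl = a∈i
    ...   | no i≢j   = ⊥-elim (¬ab (split i j i≢j a∈i b∈ p))

    -- An m-edge above b that is not below lca(a,b) lies above lca(a,b), hence above a.
    mutual
      rootPathHas-shared : ∀ {t} → RootPathHas m b t → ¬ LcaPathHas m a b t → a ∈ₗ leaves t →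
                           RootPathHas m a t
      rootPathHas-shared (step {cs} j b∈ p) ¬ab a∈ =
        step j a∈j (edgeOrPath-shared p (¬ab ∘ below j a∈j b∈) a∈j)
        where
          a∈j : a ∈ₗ leaves (child cs j)
          a∈j = sameChild j b∈ p ¬ab a∈

      edgeOrPath-shared : ∀ {l t} → m ∈ l ⊎ RootPathHas m b t → ¬ LcaPathHas m a b t → a ∈ₗ leaves t →
                          m ∈ l ⊎ RootPathHas m a t
      edgeOrPath-shared (inj₁ q) _   _  = inj₁ q
      edgeOrPath-shared (inj₂ r) ¬ab a∈ = inj₂ (rootPathHas-shared r ¬ab a∈)

    lcaPathHas-shared : ∀ {c t} → LcaPathHas m c b t → ¬ LcaPathHas m a b t → a ∈ₗ leaves t →
                        LcaPathHas m c a t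
    lcaPathHas-shared (split {cs} i j i≢j c∈ b∈ p) ¬ab a∈ =
      split i j i≢j c∈ a∈j (edgeOrPath-shared p (¬ab ∘ below j a∈j b∈) a∈j)
      where
        a∈j : a ∈ₗ leaves (child cs j)
        a∈j = sameChild j b∈ p ¬ab a∈
    lcaPathHas-shared (below {cs} i c∈ b∈ d) ¬ab a∈ =
      below i c∈ a∈i (lcaPathHas-shared d (¬ab ∘ below i a∈i b∈) a∈i)
      where
        a∈i : a ∈ₗ leaves (child cs i)
        a∈i = sameChild i b∈ (inj₂ (LcaPathHas⇒RootPathHas d)) ¬ab a∈

  -- lca(a,b) lies strictly below lca(b,c): the triple is resolved as ab|c.
  data Resolved (a b c : Fin n) : Tree n k → Set where
    split : ∀ {cs} {i j : Fin (length cs)} → i ≢ j → c ∈ₗ leaves (child cs i) →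
            a ∈ₗ leaves (child cs j) → b ∈ₗ leaves (child cs j) → Resolved a b c (node cs)
    below : ∀ {cs} {i : Fin (length cs)} → a ∈ₗ leaves (child cs i) → b ∈ₗ leaves (child cs i) →
            c ∈ₗ leaves (child cs i) → Resolved a b c (child cs i) → Resolved a b c (node cs)

  module _ {a b c : Fin n} where

    resolved : ∀ {m t} → LcaPathHas m c b t → ¬ LcaPathHas m a b t → a ∈ₗ leaves t → Resolved a b c t
    resolved (split i j i≢j c∈ b∈ p) ¬ab a∈ = split i≢j c∈ (sameChild j b∈ p ¬ab a∈) b∈
    resolved (below {cs} i c∈ b∈ d) ¬ab a∈ = below a∈i b∈ c∈ (resolved d (¬ab ∘ below i a∈i b∈) a∈i)
      where
        a∈i : a ∈ₗ leaves (child cs i)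
        a∈i = sameChild i b∈ (inj₂ (LcaPathHas⇒RootPathHas d)) ¬ab a∈

    resolved-swap : ∀ {t} → Resolved a b c t → Resolved b a c t
    resolved-swap (split i≢j c∈ a∈ b∈) = split i≢j c∈ b∈ a∈
    resolved-swap (below a∈ b∈ c∈ r)   = below b∈ a∈ c∈ (resolved-swap r)

    module _ {m : Fin k} where

      resolved-outgroup : ∀ {t} → Resolved a b c t → Unique (leaves t) →
                          LcaPathHas m a c t → LcaPathHas m b c t
      resolved-outgroup (split {cs} {i} {j} i≢j c∈ a∈ b∈) u ac =
        split j i (i≢j ∘ sym) b∈ c∈ (lcaPathHas-split⁻ cs u (i≢j ∘ sym) a∈ c∈ ac)
      resolved-outgroup (below {cs} {i} a∈ b∈ c∈ r) u ac =
        below i b∈ c∈ (resolved-outgroup r (unique⇒unique-child cs u i) (lcaPathHas-below⁻ cs u a∈ c∈ ac))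

      resolved-nested : ∀ {t} → Resolved a b c t → Unique (leaves t) →
                        LcaPathHas m a b t → LcaPathHas m c b t
      resolved-nested (split {cs} {i} {j} i≢j c∈ a∈ b∈) u ab =
        split i j i≢j c∈ b∈ (inj₂ (LcaPathHas⇒RootPathHas (lcaPathHas-below⁻ cs u a∈ b∈ ab)))
      resolved-nested (below {cs} {i} a∈ b∈ c∈ r) u ab =
        below i c∈ b∈ (resolved-nested r (unique⇒unique-child cs u i) (lcaPathHas-below⁻ cs u a∈ b∈ ab))

      resolved-fourthLeaf : ∀ {d t} → Resolved a b c t → Unique (leaves t) → d ∈ₗ leaves t →
                            LcaPathHas m a d t → LcaPathHas m b d t ⊎ LcaPathHas m c d t
      resolved-fourthLeaf (split {cs} {i} {j} i≢j c∈ a∈ b∈) u d∈ ad with ∈-leavesL⁻ cs d∈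
      ... | l , d∈l with l ≟ᶠ j
      ...   | yes refl = inj₂ (split i l i≢j c∈ d∈l
                                 (inj₂ (LcaPathHas⇒RootPathHas (lcaPathHas-below⁻ cs u a∈ d∈l ad))))
      ...   | no l≢j   = inj₁ (split j l (l≢j ∘ sym) b∈ d∈l (lcaPathHas-split⁻ cs u (l≢j ∘ sym) a∈ d∈l ad))
      resolved-fourthLeaf (below {cs} {i} a∈ b∈ c∈ r) u d∈ ad with ∈-leavesL⁻ cs d∈
      ... | l , d∈l with l ≟ᶠ i
      ...   | yes refl = Sum.map (below l b∈ d∈l) (below l c∈ d∈l)
                           (resolved-fourthLeaf r (unique⇒unique-child cs u l) d∈l (lcaPathHas-below⁻ cs u a∈ d∈l ad))
      ...   | no l≢i   = inj₂ (split i l (l≢i ∘ sym) c∈ d∈l (lcaPathHas-split⁻ cs u (l≢i ∘ sym) a∈ d∈l ad))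

module _ {n k : ℕ} {ε : ColorMap {n} {k}} {t : Tree n k}
         (u : Unique (leaves t)) (complete : ∀ x → x ∈ₗ leaves t) (explains : Explains t ε) where

  private
    ε⇒path : ∀ {x y m} → x ≢ y → m ∈ ε x y → LcaPathHas m x y t
    ε⇒path x≢y = to (explains _ _ x≢y _)

    path⇒ε : ∀ {x y m} → x ≢ y → LcaPathHas m x y t → m ∈ ε x y
    path⇒ε x≢y = from (explains _ _ x≢y _)

    resolvedBy : ∀ {a b c m} → a ≢ b → b ≢ c → m ∈ ε c b → m ∉ ε a b → Resolved a b c t
    resolvedBy {a} a≢b b≢c m∈cb m∉ab = resolved (ε⇒path (b≢c ∘ sym) m∈cb) (m∉ab ∘ path⇒ε a≢b) (complete a)

  condI-refuted : ∀ {m m'} → ¬ CondI ε m m'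
  condI-refuted (a , b , c , a≢b , a≢c , b≢c , m∈cb , m∉ab , inj₁ m∉ca) =
    m∉ca (path⇒ε (a≢c ∘ sym) (lcaPathHas-shared (ε⇒path (b≢c ∘ sym) m∈cb) (m∉ab ∘ path⇒ε a≢b) (complete a)))
  condI-refuted (a , b , c , a≢b , a≢c , b≢c , m∈cb , m∉ab , inj₂ (inj₁ (m'∉ac , m'∈bc))) =
    m'∉ac (path⇒ε a≢c (resolved-outgroup (resolved-swap (resolvedBy a≢b b≢c m∈cb m∉ab)) u (ε⇒path b≢c m'∈bc)))
  condI-refuted (a , b , c , a≢b , a≢c , b≢c , m∈cb , m∉ab , inj₂ (inj₂ (inj₁ (m'∈ac , m'∉bc)))) =
    m'∉bc (path⇒ε b≢c (resolved-outgroup (resolvedBy a≢b b≢c m∈cb m∉ab) u (ε⇒path a≢c m'∈ac)))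
  condI-refuted (a , b , c , a≢b , a≢c , b≢c , m∈cb , m∉ab , inj₂ (inj₂ (inj₂ (_ , m'∉cb , m'∈ab)))) =
    m'∉cb (path⇒ε (b≢c ∘ sym) (resolved-nested (resolvedBy a≢b b≢c m∈cb m∉ab) u (ε⇒path a≢b m'∈ab)))

  condII-refuted : ∀ {m m'} → ¬ CondII ε m m'
  condII-refuted (a , b , c , d , a≢b , _ , a≢d , b≢c , b≢d , c≢d , m∈cb , m∉ab , _ , m'∉bd , m'∉cd , m'∈ad) =
    [ m'∉bd ∘ path⇒ε b≢d , m'∉cd ∘ path⇒ε c≢d ]
      (resolved-fourthLeaf (resolvedBy a≢b b≢c m∈cb m∉ab) u (complete d) (ε⇒path a≢d m'∈ad))

conditions⇒¬fitch : ∀ {n k} {ε : ColorMap {n} {k}} {m m'} → CondI ε m m' ⊎ CondII ε m m' → ¬ IsFitch ε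
conditions⇒¬fitch cond (_ , (_ , u , complete) , explains) =
  [ condI-refuted u complete explains , condII-refuted u complete explains ] cond

module _ {n : ℕ} {P : Fin n → Set} (P? : U.Decidable P) where

  toSubset : Subset n
  toSubset = tabulate (does ∘ P?)

  ∈-toSubset⁺ : ∀ {x} → P x → x ∈ toSubset
  ∈-toSubset⁺ {x} p = lookup⇒[]= x toSubset (trans (lookup∘tabulate _ x) (dec-true (P? x) p))

  ∈-toSubset⁻ : ∀ {x} → x ∈ toSubset → P x
  ∈-toSubset⁻ {x} x∈ with P? x | trans (sym (lookup∘tabulate (does ∘ P?) x)) ([]=⇒lookup x∈)
  ... | yes p | _  = p
  ... | no _  | ()

module _ {A : Set} {P : A → Set} (P? : U.Decidable P) (f : A → ℕ) where

  private
    into-filter : ∀ xs {b} → b ∈ₗ xs → P b → b ∈ₗ filter P? xs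
    into-filter _ = ∈-filter⁺ P?

  none⊎maximal : ∀ xs → (∀ {a} → a ∈ₗ xs → ¬ P a) ⊎ ∃[ a ] (P a × ∀ {b} → b ∈ₗ xs → P b → f b ≤ f a)
  none⊎maximal xs with filter P? xs | all-filter P? xs | into-filter xs
  ... | []     | _        | into = inj₁ λ a∈ pa → case into a∈ pa of λ ()
  ... | c ∷ cs | pc ∷ pcs | into = inj₂ (argmax f c cs , argmax-all f pc pcs , λ b∈ pb → bound (into b∈ pb))
    where
      bound : ∀ {b} → b ∈ₗ c ∷ cs → f b ≤ f (argmax f c cs)
      bound (here refl) = f[⊥]≤f[argmax] {f = f} c cs
      bound (there b∈)  = All.lookup (f[xs]≤f[argmax] {f = f} c cs) b∈

∈∉⇒≢ : ∀ {A : Set} {P : A → Set} {x z} → P x → ¬ P z → x ≢ z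
∈∉⇒≢ px ¬pz refl = ¬pz px

module Sufficiency {n k : ℕ} (ε : ColorMap {n} {k})
                   (¬conditions : ∀ m m' → ¬ (CondI ε m m' ⊎ CondII ε m m')) where

  ¬cond1 : ∀ {m a b c} → a ≢ b → a ≢ c → b ≢ c → m ∈ ε c b → m ∉ ε a b → m ∈ ε c a
  ¬cond1 {m} {a} {b} {c} a≢b a≢c b≢c m∈cb m∉ab = decidable-stable (m ∈? ε c a) λ m∉ca →
    ¬conditions m m (inj₁ (a , b , c , a≢b , a≢c , b≢c , m∈cb , m∉ab , inj₁ m∉ca))

  ¬cond2a : ∀ {m m' a b c} → a ≢ b → a ≢ c → b ≢ c → m ∈ ε c b → m ∉ ε a b → m' ∉ ε a c → m' ∈ ε b c → ⊥
  ¬cond2a {m} {m'} {a} {b} {c} a≢b a≢c b≢c m∈cb m∉ab m'∉ac m'∈bc =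
    ¬conditions m m' (inj₁ (a , b , c , a≢b , a≢c , b≢c , m∈cb , m∉ab , inj₂ (inj₁ (m'∉ac , m'∈bc))))

  ¬cond2b : ∀ {m m' a b c} → a ≢ b → a ≢ c → b ≢ c → m ∈ ε c b → m ∉ ε a b → m' ∈ ε a c → m' ∉ ε b c → ⊥
  ¬cond2b {m} {m'} {a} {b} {c} a≢b a≢c b≢c m∈cb m∉ab m'∈ac m'∉bc =
    ¬conditions m m' (inj₁ (a , b , c , a≢b , a≢c , b≢c , m∈cb , m∉ab , inj₂ (inj₂ (inj₁ (m'∈ac , m'∉bc)))))

  ¬cond3 : ∀ {m m' a b c} → a ≢ b → a ≢ c → b ≢ c → m ∈ ε c b → m ∉ ε a b → m' ∈ ε a b → m' ∈ ε c b
  ¬cond3 {m} {m'} {a} {b} {c} a≢b a≢c b≢c m∈cb m∉ab m'∈ab = decidable-stable (m' ∈? ε c b) λ m'∉cb →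
    ¬conditions m m' (inj₁ (a , b , c , a≢b , a≢c , b≢c , m∈cb , m∉ab ,
                            inj₂ (inj₂ (inj₂ (∈∉⇒≢ m'∈ab m∉ab ∘ sym , m'∉cb , m'∈ab)))))

  ¬cond4 : ∀ {m m' a b c d} → a ≢ b → a ≢ c → a ≢ d → b ≢ c → b ≢ d → c ≢ d →
           m ∈ ε c b → m ∉ ε a b → m ≢ m' → m' ∉ ε b d → m' ∉ ε c d → m' ∈ ε a d → ⊥
  ¬cond4 {m} {m'} {a} {b} {c} {d} a≢b a≢c a≢d b≢c b≢d c≢d m∈cb m∉ab m≢m' m'∉bd m'∉cd m'∈ad =
    ¬conditions m m' (inj₂ (a , b , c , d , a≢b , a≢c , a≢d , b≢c , b≢d , c≢d ,
                            m∈cb , m∉ab , m≢m' , m'∉bd , m'∉cd , m'∈ad))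

  -- In a tree explaining ε: the leaves below the lowest m-edge above y.
  Clade : Fin k → Fin n → Fin n → Set
  Clade m y x = x ≡ y ⊎ m ∉ ε x y

  clade? : ∀ m y x → Dec (Clade m y x)
  clade? m y x = (x ≟ᶠ y) ⊎-dec ¬? (m ∈? ε x y)

  clade⁻ : ∀ {m y x} → Clade m y x → x ≢ y → m ∉ ε x y
  clade⁻ (inj₁ x≡y) x≢y = ⊥-elim (x≢y x≡y)
  clade⁻ (inj₂ m∉)  _   = m∉

  ¬clade⁻ : ∀ {m y x} → ¬ Clade m y x → x ≢ y × m ∈ ε x y
  ¬clade⁻ {m} {y} {x} x∉ = x∉ ∘ inj₁ , decidable-stable (m ∈? ε x y) (x∉ ∘ inj₂)

  private
    sameLeaf-clades-nested : ∀ {m m' y u v} → Clade m y u → ¬ Clade m' y u → Clade m' y v → ¬ Clade m y v → ⊥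
    sameLeaf-clades-nested u∈A u∉A' v∈A' v∉A =
      let u≢y , m'∈uy = ¬clade⁻ u∉A'
          v≢y , m∈vy  = ¬clade⁻ v∉A
      in clade⁻ v∈A' v≢y (¬cond3 u≢y (∈∉⇒≢ u∈A v∉A) (v≢y ∘ sym) m∈vy (clade⁻ u∈A u≢y) m'∈uy)

    clades-comparable : ∀ {m m' y y' u v} → y ≢ y' → Clade m' y' y →
                        Clade m y u → ¬ Clade m' y' u → Clade m' y' v → ¬ Clade m y v → ⊥
    clades-comparable {m} {m'} {y} {y'} {u} {v} y≢y' y∈A' u∈A u∉A' v∈A' v∉A =
      let u≢y' , m'∈uy' = ¬clade⁻ u∉A'
          v≢y  , m∈vy   = ¬clade⁻ v∉A
          u≢y     = ∈∉⇒≢ y∈A' u∉A' ∘ sym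
          m∉uy    = clade⁻ u∈A u≢y
          m'∉yy'  = clade⁻ y∈A' y≢y'
          m'∈uy   = ¬cond1 y≢y' (u≢y ∘ sym) (u≢y' ∘ sym) m'∈uy' m'∉yy'
      in case v ≟ᶠ y' of λ where
           (yes v≡y') → ¬cond2b u≢y u≢y' y≢y' (subst (λ z → m ∈ ε z y) v≡y' m∈vy) m∉uy m'∈uy' m'∉yy'
           (no v≢y')  → ¬cond4 u≢y (∈∉⇒≢ u∈A v∉A) u≢y' (v≢y ∘ sym) y≢y' v≢y' m∈vy m∉uy
                               (∈∉⇒≢ m'∈uy m∉uy ∘ sym) m'∉yy' (clade⁻ v∈A' v≢y') m'∈uy'

  clades-laminar : ∀ {m m' y y' u v w} → Clade m y u → ¬ Clade m' y' u → Clade m' y' v → ¬ Clade m y v →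
                   Clade m y w → Clade m' y' w → ⊥
  clades-laminar {m} {m'} {y} {y'} u∈A u∉A' v∈A' v∉A w∈A w∈A' with y ≟ᶠ y'
  ... | yes refl = sameLeaf-clades-nested u∈A u∉A' v∈A' v∉A
  ... | no y≢y' with clade? m' y' y | clade? m y y'
  ...   | yes y∈A' | _        = clades-comparable y≢y' y∈A' u∈A u∉A' v∈A' v∉A
  ...   | no _     | yes y'∈A = clades-comparable (y≢y' ∘ sym) y'∈A v∈A' v∉A u∈A u∉A'
  ...   | no y∉A'  | no y'∉A  =
          let w≢y = ∈∉⇒≢ w∈A' y∉A'
              w≢y' = ∈∉⇒≢ w∈A y'∉A
          in ¬cond2a w≢y w≢y' y≢y' (proj₂ (¬clade⁻ y'∉A)) (clade⁻ w∈A w≢y) (clade⁻ w∈A' w≢y')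
                     (proj₂ (¬clade⁻ y∉A'))

  -- Within the tree built on S, the root-to-y path carries m exactly when this holds.
  RootEdge : Subset n → Fin k → Fin n → Set
  RootEdge S m y = ∃[ z ] (z ∈ S × z ≢ y × m ∈ ε z y)

  rootEdge? : ∀ S m y → Dec (RootEdge S m y)
  rootEdge? S m y = any? λ z → (z ∈? S) ×-dec ¬? (z ≟ᶠ y) ×-dec (m ∈? ε z y)

  rootEdge-mono : ∀ {S S' m y} → S ⊆ S' → RootEdge S m y → RootEdge S' m y
  rootEdge-mono S⊆S' (z , z∈ , z≢y , m∈) = z , S⊆S' z∈ , z≢y , m∈

  record Realization (S : Subset n) : Set where
    field
      tree      : Tree n k
      branching : Branching tree
      unique    : Unique (leaves tree)
      leaves⇔   : ∀ {x} → x ∈ S ⇔ x ∈ₗ leaves tree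
      explains  : ∀ {x y} → x ∈ S → y ∈ S → x ≢ y → ∀ m → m ∈ ε x y ⇔ LcaPathHas m x y tree
      rootPath  : ∀ {y} → y ∈ S → ∀ m → RootEdge S m y ⇔ RootPathHas m y tree

  open Realization

  singleton-realization : ∀ {S y₀} → y₀ ∈ S → (∀ {x} → x ∈ S → x ≡ y₀) → Realization S
  singleton-realization {S} {y₀} y₀∈ only = record
    { tree      = leaf y₀
    ; branching = leaf
    ; unique    = [] ∷ []
    ; leaves⇔   = mk⇔ (here ∘ only) λ { (here refl) → y₀∈ }
    ; explains  = λ x∈ y∈ x≢y _ → ⊥-elim (x≢y (trans (only x∈) (sym (only y∈))))
    ; rootPath  = λ y∈ _ → mk⇔ (λ (z , z∈ , z≢y , _) → ⊥-elim (z≢y (trans (only z∈) (sym (only y∈))))) λ ()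
    }

  Separated : Subset n → Subset n → Subset n → Set
  Separated S B B' = ∀ {x y} → x ∈ B → y ∈ B' → ∀ {m} → RootEdge S m y → m ∈ ε x y

  record Split (S : Subset n) : Set where
    field
      B B'        : Subset n
      B⊆S         : B ⊆ S
      B'⊆S        : B' ⊆ S
      cover       : ∀ {x} → x ∈ S → x ∈ B ⊎ x ∈ B'
      apart       : ∀ {x x'} → x ∈ B → x' ∈ B' → x ≢ x'
      B-nonempty  : Nonempty B
      B'-nonempty : Nonempty B'
      separated   : Separated S B B'
      separated'  : Separated S B' B

    B⊂S : B ⊂ S
    B⊂S = let b' , b'∈ = B'-nonempty in B⊆S , b' , B'⊆S b'∈ , λ b'∈B → apart b'∈B b'∈ refl

    B'⊂S : B' ⊂ S
    B'⊂S = let b , b∈ = B-nonempty in B'⊆S , b , B⊆S b∈ , λ b∈B' → apart b∈ b∈B' refl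

  seenByAll? : ∀ S B m → Dec (∀ y → y ∈ B → RootEdge S m y)
  seenByAll? S B m = all? λ y → (y ∈? B) →-dec rootEdge? S m y

  edgeLabel : Subset n → Subset n → Subset k
  edgeLabel S B = toSubset (seenByAll? S B)

  module Side {S B B' : Subset n} (r : Realization B) (B⊆S : B ⊆ S) (B'⊆S : B' ⊆ S)
              (apart : ∀ {x x'} → x ∈ B → x' ∈ B' → x ≢ x') (B'-nonempty : Nonempty B')
              (separated : Separated S B' B) where

    -- Through any leaf of B', ¬cond1 transfers the colour from y to every other leaf of B.
    rootEdge-everywhere : ∀ {y m} → y ∈ B → RootEdge S m y → ¬ RootEdge B m y →
                          ∀ {y'} → y' ∈ B → RootEdge S m y'
    rootEdge-everywhere {y} y∈ e ¬eB {y'} y'∈ with y' ≟ᶠ y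
    ... | yes refl = e
    ... | no y'≢y  =
          let b' , b'∈ = B'-nonempty
          in b' , B'⊆S b'∈ , apart y'∈ b'∈ ∘ sym ,
             ¬cond1 y'≢y (apart y'∈ b'∈) (apart y∈ b'∈) (separated b'∈ y∈ e) λ m∈ → ¬eB (y' , y'∈ , y'≢y , m∈)

    edgeOrPath⇔rootEdge : ∀ {y} → y ∈ B → ∀ m →
                          (m ∈ edgeLabel S B ⊎ RootPathHas m y (tree r)) ⇔ RootEdge S m y
    edgeOrPath⇔rootEdge {y} y∈ m = mk⇔ fromChild toChild
      where
        fromChild : m ∈ edgeLabel S B ⊎ RootPathHas m y (tree r) → RootEdge S m y
        fromChild (inj₁ m∈) = ∈-toSubset⁻ (seenByAll? S B) m∈ y y∈
        fromChild (inj₂ p)  = rootEdge-mono B⊆S (from (rootPath r y∈ m) p)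

        toChild : RootEdge S m y → m ∈ edgeLabel S B ⊎ RootPathHas m y (tree r)
        toChild e with rootEdge? B m y
        ... | yes eB = inj₂ (to (rootPath r y∈ m) eB)
        ... | no ¬eB = inj₁ (∈-toSubset⁺ (seenByAll? S B) λ _ y'∈ → rootEdge-everywhere y∈ e ¬eB y'∈)

  module Combine {S : Subset n} (sp : Split S) (r₁ : Realization (Split.B sp)) (r₂ : Realization (Split.B' sp)) where

    open Split sp

    private
      module S₁ = Side r₁ B⊆S B'⊆S apart B'-nonempty separated'
      module S₂ = Side r₂ B'⊆S B⊆S (λ x∈ x'∈ → apart x'∈ x∈ ∘ sym) B-nonempty separated

      t₁ t₂ : Tree n k
      t₁ = tree r₁
      t₂ = tree r₂

      in₁ : ∀ {x} → x ∈ₗ leaves t₁ → x ∈ B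
      in₁ = from (leaves⇔ r₁)

      in₂ : ∀ {x} → x ∈ₗ leaves t₂ → x ∈ B'
      in₂ = from (leaves⇔ r₂)

    T : Tree n k
    T = node ((edgeLabel S B , t₁) ∷ (edgeLabel S B' , t₂) ∷ [])

    T-unique : Unique (leaves T)
    T-unique = ++⁺ (unique r₁) (++⁺ (unique r₂) [] λ ()) disjoint
      where
        disjoint : Disjoint (leaves t₁) (leaves t₂ ++ [])
        disjoint (x∈₁ , x∈₂) with ∈-++⁻ (leaves t₂) x∈₂
        ... | inj₁ x∈₂' = apart (in₁ x∈₁) (in₂ x∈₂') refl

    T-leaves⇔ : ∀ {x} → x ∈ S ⇔ x ∈ₗ leaves T
    T-leaves⇔ = mk⇔ intoT fromT
      where
        intoT : ∀ {x} → x ∈ S → x ∈ₗ leaves T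
        intoT x∈ = [ ∈-++⁺ˡ ∘ to (leaves⇔ r₁) , ∈-++⁺ʳ (leaves t₁) ∘ ∈-++⁺ˡ ∘ to (leaves⇔ r₂) ]′ (cover x∈)

        fromT : ∀ {x} → x ∈ₗ leaves T → x ∈ S
        fromT x∈ with ∈-++⁻ (leaves t₁) x∈
        ... | inj₁ x∈₁ = B⊆S (in₁ x∈₁)
        ... | inj₂ x∈' with ∈-++⁻ (leaves t₂) x∈'
        ...   | inj₁ x∈₂ = B'⊆S (in₂ x∈₂)

    ε⇒lcaPath : ∀ {x y} → x ∈ S → y ∈ S → x ≢ y → ∀ {m} → m ∈ ε x y → LcaPathHas m x y T
    ε⇒lcaPath {x} {y} x∈ y∈ x≢y {m} m∈ with cover x∈ | cover y∈
    ... | inj₁ xB | inj₁ yB = below zero (to (leaves⇔ r₁) xB) (to (leaves⇔ r₁) yB) (to (explains r₁ xB yB x≢y m) m∈)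
    ... | inj₁ xB | inj₂ yB = split zero (suc zero) (λ ()) (to (leaves⇔ r₁) xB) (to (leaves⇔ r₂) yB)
                                (from (S₂.edgeOrPath⇔rootEdge yB m) (x , x∈ , x≢y , m∈))
    ... | inj₂ xB | inj₁ yB = split (suc zero) zero (λ ()) (to (leaves⇔ r₂) xB) (to (leaves⇔ r₁) yB)
                                (from (S₁.edgeOrPath⇔rootEdge yB m) (x , x∈ , x≢y , m∈))
    ... | inj₂ xB | inj₂ yB = below (suc zero) (to (leaves⇔ r₂) xB) (to (leaves⇔ r₂) yB) (to (explains r₂ xB yB x≢y m) m∈)

    lcaPath⇒ε : ∀ {x y} → x ≢ y → ∀ {m} → LcaPathHas m x y T → m ∈ ε x y
    lcaPath⇒ε _   (split zero          zero          i≢i _ _ _) = ⊥-elim (i≢i refl)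
    lcaPath⇒ε _   (split zero          (suc zero)    _ x∈ y∈ p) =
      separated (in₁ x∈) (in₂ y∈) (to (S₂.edgeOrPath⇔rootEdge (in₂ y∈) _) p)
    lcaPath⇒ε _   (split (suc zero)    zero          _ x∈ y∈ p) =
      separated' (in₂ x∈) (in₁ y∈) (to (S₁.edgeOrPath⇔rootEdge (in₁ y∈) _) p)
    lcaPath⇒ε _   (split (suc zero)    (suc zero)    i≢i _ _ _) = ⊥-elim (i≢i refl)
    lcaPath⇒ε x≢y (below zero       x∈ y∈ d) = from (explains r₁ (in₁ x∈) (in₁ y∈) x≢y _) d
    lcaPath⇒ε x≢y (below (suc zero) x∈ y∈ d) = from (explains r₂ (in₂ x∈) (in₂ y∈) x≢y _) d

    T-rootPath : ∀ {y} → y ∈ S → ∀ m → RootEdge S m y ⇔ RootPathHas m y T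
    T-rootPath y∈ m = mk⇔ rootEdge⇒path path⇒rootEdge
      where
        rootEdge⇒path : RootEdge S m _ → RootPathHas m _ T
        rootEdge⇒path e with cover y∈
        ... | inj₁ yB = step zero (to (leaves⇔ r₁) yB) (from (S₁.edgeOrPath⇔rootEdge yB m) e)
        ... | inj₂ yB = step (suc zero) (to (leaves⇔ r₂) yB) (from (S₂.edgeOrPath⇔rootEdge yB m) e)

        path⇒rootEdge : RootPathHas m _ T → RootEdge S m _
        path⇒rootEdge (step zero       y∈₁ p) = to (S₁.edgeOrPath⇔rootEdge (in₁ y∈₁) m) p
        path⇒rootEdge (step (suc zero) y∈₂ p) = to (S₂.edgeOrPath⇔rootEdge (in₂ y∈₂) m) p

    combined : Realization S
    combined = record
      { tree      = T
      ; branching = node (s≤s (s≤s z≤n)) (branching r₁ ∷ branching r₂ ∷ [])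
      ; unique    = T-unique
      ; leaves⇔   = T-leaves⇔
      ; explains  = λ x∈ y∈ x≢y m → mk⇔ (ε⇒lcaPath x∈ y∈ x≢y) (lcaPath⇒ε x≢y)
      ; rootPath  = T-rootPath
      }

  CladeCompatible : Subset n → Subset n → Set
  CladeCompatible S G = ∀ {m y} → y ∈ S → RootEdge S m y →
                        ∀ {x z} → x ∈ G → Clade m y x → z ∈ S → z ∉ G → Clade m y z → ⊥

  compatible⇒split : ∀ {S G} → G ⊆ S → Nonempty G → ∃[ z ] (z ∈ S × z ∉ G) → CladeCompatible S G → Split S
  compatible⇒split {S} {G} G⊆S G-nonempty (z , z∈ , z∉) compatible = record
    { B           = G
    ; B'          = toSubset outside?
    ; B⊆S         = G⊆S
    ; B'⊆S        = proj₁ ∘ outside⁻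
    ; cover       = cover
    ; apart       = λ x∈ x'∈ → ∈∉⇒≢ x∈ (proj₂ (outside⁻ x'∈))
    ; B-nonempty  = G-nonempty
    ; B'-nonempty = z , ∈-toSubset⁺ outside? (z∈ , z∉)
    ; separated   = λ {x} {y} x∈ y∈ {m} e → decidable-stable (m ∈? ε x y) λ m∉ →
                      let y∈S , y∉G = outside⁻ y∈ in compatible y∈S e x∈ (inj₂ m∉) y∈S y∉G (inj₁ refl)
    ; separated'  = λ {x} {y} x∈ y∈ {m} e → decidable-stable (m ∈? ε x y) λ m∉ →
                      let x∈S , x∉G = outside⁻ x∈ in compatible (G⊆S y∈) e y∈ (inj₁ refl) x∈S x∉G (inj₂ m∉)
    }
    where
      outside? : ∀ x → Dec (x ∈ S × x ∉ G)
      outside? x = (x ∈? S) ×-dec ¬? (x ∈? G)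

      outside⁻ : ∀ {x} → x ∈ toSubset outside? → x ∈ S × x ∉ G
      outside⁻ = ∈-toSubset⁻ outside?

      cover : ∀ {x} → x ∈ S → x ∈ G ⊎ x ∈ toSubset outside?
      cover {x} x∈ with x ∈? G
      ... | yes x∈G = inj₁ x∈G
      ... | no x∉G  = inj₂ (∈-toSubset⁺ outside? (x∈ , x∉G))

  inClade? : ∀ S m y x → Dec (x ∈ S × Clade m y x)
  inClade? S m y x = (x ∈? S) ×-dec clade? m y x

  cladeIn : Subset n → Fin k → Fin n → Subset n
  cladeIn S m y = toSubset (inClade? S m y)

  Candidate : Subset n → Fin k × Fin n → Set
  Candidate S (m , y) = y ∈ S × RootEdge S m y

  candidate? : ∀ S p → Dec (Candidate S p)
  candidate? S (m , y) = (y ∈? S) ×-dec rootEdge? S m y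

  colourLeafPairs : List (Fin k × Fin n)
  colourLeafPairs = cartesianProduct (allFin k) (allFin n)

  ∈-colourLeafPairs : ∀ m y → (m , y) ∈ₗ colourLeafPairs
  ∈-colourLeafPairs m y = ∈-cartesianProduct⁺ (∈-allFin m) (∈-allFin y)

  -- Cut along a largest clade of a root colour (any cut if there is none): by laminarity, a clade
  -- straddling it would be strictly larger.
  findSplit : ∀ {S x y} → x ∈ S → y ∈ S → x ≢ y → Split S
  findSplit {S} {x} {y} x∈ y∈ x≢y
    with none⊎maximal (candidate? S) (λ (m , y') → ∣ cladeIn S m y' ∣) colourLeafPairs
  ... | inj₁ none =
        compatible⇒split (λ u∈ → subst (_∈ S) (sym (x∈⁅y⁆⇒x≡y y u∈)) y∈) (y , x∈⁅x⁆ y)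
          (x , x∈ , x≢y ∘ x∈⁅y⁆⇒x≡y y) λ {m} {y'} y'∈ e → ⊥-elim (none (∈-colourLeafPairs m y') (y'∈ , e))
  ... | inj₂ ((m₀ , y₀) , (y₀∈ , z , z∈ , z≢y₀ , m₀∈) , maximal) =
        compatible⇒split (proj₁ ∘ inG⁻) (y₀ , inG⁺ (y₀∈ , inj₁ refl))
          (z , z∈ , λ z∈G → clade⁻ (proj₂ (inG⁻ z∈G)) z≢y₀ m₀∈) compatible
    where
      inG⁺ : ∀ {w} → w ∈ S × Clade m₀ y₀ w → w ∈ cladeIn S m₀ y₀
      inG⁺ = ∈-toSubset⁺ (inClade? S m₀ y₀)

      inG⁻ : ∀ {w} → w ∈ cladeIn S m₀ y₀ → w ∈ S × Clade m₀ y₀ w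
      inG⁻ = ∈-toSubset⁻ (inClade? S m₀ y₀)

      compatible : CladeCompatible S (cladeIn S m₀ y₀)
      compatible {m} {y'} y'∈ e {u} {v} u∈G u∈A v∈S v∉G v∈A =
        <⇒≱ (p⊂q⇒∣p∣<∣q∣ G⊂A) (maximal (∈-colourLeafPairs m y') (y'∈ , e))
        where
          G⊂A : cladeIn S m₀ y₀ ⊂ cladeIn S m y'
          G⊂A = (λ {w} w∈G → ∈-toSubset⁺ (inClade? S m y') (proj₁ (inG⁻ w∈G) ,
                  decidable-stable (clade? m y' w) λ w∉A →
                    clades-laminar (proj₂ (inG⁻ w∈G)) w∉A v∈A (v∉G ∘ inG⁺ ∘ (v∈S ,_)) (proj₂ (inG⁻ u∈G)) u∈A))
              , v , ∈-toSubset⁺ (inClade? S m y') (v∈S , v∈A) , v∉G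

  realize : ∀ S → Acc _<_ ∣ S ∣ → ∀ {y₀} → y₀ ∈ S → Realization S
  realize S (acc smaller) {y₀} y₀∈ with any? (λ x → (x ∈? S) ×-dec ¬? (x ≟ᶠ y₀))
  ... | no ¬other =
        singleton-realization y₀∈ λ {x} x∈ → decidable-stable (x ≟ᶠ y₀) λ x≢y₀ → ¬other (x , x∈ , x≢y₀)
  ... | yes (x₁ , x₁∈ , x₁≢y₀) =
        Combine.combined sp (realize B  (smaller (p⊂q⇒∣p∣<∣q∣ B⊂S))  (proj₂ B-nonempty))
                            (realize B' (smaller (p⊂q⇒∣p∣<∣q∣ B'⊂S)) (proj₂ B'-nonempty))
    where
      sp : Split S
      sp = findSplit x₁∈ y₀∈ x₁≢y₀
      open Split sp

  fitch : Fin n → IsFitch ε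
  fitch y₀ = tree r , (branching r , unique r , λ _ → to (leaves⇔ r) ∈⊤) , λ _ _ x≢y m → explains r ∈⊤ ∈⊤ x≢y m
    where
      r : Realization ⊤
      r = realize ⊤ (<-wellFounded _) {y₀} ∈⊤

module _ {n k : ℕ} (ε : ColorMap {n} {k}) where

  condI? : ∀ m m' → Dec (CondI ε m m')
  condI? m m' = any? λ a → any? λ b → any? λ c →
    ¬? (a ≟ᶠ b) ×-dec ¬? (a ≟ᶠ c) ×-dec ¬? (b ≟ᶠ c) ×-dec (m ∈? ε c b) ×-dec ¬? (m ∈? ε a b) ×-dec
    (¬? (m ∈? ε c a)
     ⊎-dec (¬? (m' ∈? ε a c) ×-dec (m' ∈? ε b c))
     ⊎-dec ((m' ∈? ε a c) ×-dec ¬? (m' ∈? ε b c))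
     ⊎-dec (¬? (m ≟ᶠ m') ×-dec ¬? (m' ∈? ε c b) ×-dec (m' ∈? ε a b)))

  condII? : ∀ m m' → Dec (CondII ε m m')
  condII? m m' = any? λ a → any? λ b → any? λ c → any? λ d →
    ¬? (a ≟ᶠ b) ×-dec ¬? (a ≟ᶠ c) ×-dec ¬? (a ≟ᶠ d) ×-dec ¬? (b ≟ᶠ c) ×-dec ¬? (b ≟ᶠ d) ×-dec ¬? (c ≟ᶠ d) ×-dec
    (m ∈? ε c b) ×-dec ¬? (m ∈? ε a b) ×-dec
    ¬? (m ≟ᶠ m') ×-dec ¬? (m' ∈? ε b d) ×-dec ¬? (m' ∈? ε c d) ×-dec (m' ∈? ε a d)

  conditions? : Dec (∃[ m ] ∃[ m' ] (CondI ε m m' ⊎ CondII ε m m'))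
  conditions? = any? λ m → any? λ m' → condI? m m' ⊎-dec condII? m m'

lemma3 : (n k : ℕ) → 1 ≤ n → 1 ≤ k → (ε : Fin n → Fin n → Subset k) →
    (¬ IsFitch ε) ⇔ (∃[ m ] ∃[ m' ] (CondI ε m m' ⊎ CondII ε m m'))
lemma3 zero    _ () _ _
lemma3 (suc n) k _ _ ε = mk⇔ ¬fitch⇒conditions λ (_ , _ , cond) → conditions⇒¬fitch cond
  where
    ¬fitch⇒conditions : ¬ IsFitch ε → ∃[ m ] ∃[ m' ] (CondI ε m m' ⊎ CondII ε m m')
    ¬fitch⇒conditions ¬fitch with conditions? ε
    ... | yes cond = cond
    ... | no ¬cond = ⊥-elim (¬fitch (Sufficiency.fitch ε (λ m m' cond → ¬cond (m , m' , cond)) zero))
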